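{- Let $n\ge 1$ and $0\le r\le \lceil n/2\rceil$ be integers, and let $d_\star=d_\star(r,n)$ be an integer maximising $q_n^{r,d}$ over $d\in\mathbb{Z}$. Then either \[ d_\star = \left\lceil \frac{(n-2r)^2+2n-5r-1}{n-r+3}\right\rceil \] or \[ d_\star = \frac{(n-2r)^2+2n-5r-1}{n-r+3}+1. \]
   Context: $P_n$ is the path on vertex set $[n]=\{1,\dots,n\}$ with edges $\{i,i+1\}$, $1\le i\le n-1$. $Q(P_n)$ is the collection of subsets of $[n]$ containing no two consecutive integers; $Q^{(r)}(P_n)$ is the set of its members of size $r$. For $A\in Q(P_n)$, $d^+(A)=|\{b\in[n]\setminus A:\ A\cup\{b\}\in Q(P_n)\}|$. $q_n^{r,d}$ is the number of $A\in Q^{(r)}(P_n)$ with $d^+(A)=d$. -}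

module Defs where

open import Data.Bool using (Bool; true; false; _∧_; _∨_; not; if_then_else_)
open import Data.Nat as ℕ using (ℕ; zero; suc; _≡ᵇ_)
open import Data.Fin using (Fin)
open import Data.Vec using (Vec; []; _∷_; lookup; _[_]≔_)
open import Data.List using (List; []; _∷_; map; _++_; length; filterᵇ)
open import Data.Fin using (Fin)
open import Data.List using (allFin)
open import Data.Integer as ℤ using (ℤ; +_; -[1+_]; -_; _/ℕ_)

-- A subset A of [n] = {1,…,n} is a characteristic vector v : Vec Bool n,
-- where entry i (i : Fin n, 0-based) tells whether vertex i+1 ∈ A.

allSubsets : (n : ℕ) → List (Vec Bool n)
allSubsets zero    = [] ∷ []
allSubsets (suc n) = map (false ∷_) (allSubsets n) ++ map (true ∷_) (allSubsets n)

noTwoConsecutive : ∀ {n} → Vec Bool n → Bool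
noTwoConsecutive []                = true
noTwoConsecutive (x ∷ [])          = true
noTwoConsecutive (x ∷ y ∷ xs)      = not (x ∧ y) ∧ noTwoConsecutive (y ∷ xs)

size : ∀ {n} → Vec Bool n → ℕ
size []           = 0
size (true ∷ xs)  = suc (size xs)
size (false ∷ xs) = size xs

dplus : ∀ {n} → Vec Bool n → ℕ
dplus {n} A =
  length (filterᵇ (λ b → not (lookup A b) ∧ noTwoConsecutive (A [ b ]≔ true)) (allFin n))

q : ℕ → ℕ → ℕ → ℕ
q n r d = length (filterᵇ
  (λ A → noTwoConsecutive A ∧ (size A ≡ᵇ r) ∧ (dplus A ≡ᵇ d)) (allSubsets n))

-- q_n^{r,d} for d ∈ ℤ (zero for negative d, since d⁺(A) ≥ 0)
qℤ : ℕ → ℕ → ℤ → ℕ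
qℤ n r (+ d)      = q n r d
qℤ n r -[1+ _ ]   = 0

-- ⌈ a / b ⌉ for a ∈ ℤ and b a positive natural number
-- (_/ℕ_ is floor division for a positive divisor; ⌈a/b⌉ = -⌊-a/b⌋)
ceilDiv : (a : ℤ) (b : ℕ) .{{_ : ℕ.NonZero b}} → ℤ
ceilDiv a b = - ((- a) /ℕ b)

numer : ℕ → ℕ → ℤ
numer n r = let m = + n ℤ.- + 2 ℤ.* + r in
  m ℤ.* m ℤ.+ + 2 ℤ.* + n ℤ.- + 5 ℤ.* + r ℤ.- + 1

-- denominator n - r + 3 (used only when r ≤ n, so truncated ∸ is exact)
denom : ℕ → ℕ → ℕ
denom n r = (n ℕ.∸ r) ℕ.+ 3

ceilValue : ℕ → ℕ → ℤ
ceilValue n r = ceilDiv (numer n r) (suc (suc (suc (n ℕ.∸ r))))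

-- For r ≥ 1 an independent r-set of P_n cuts the path into r + 1 gaps, the inner ones of length
-- at least 1 and the two end ones of length at least 0. A gap exceeding its minimal length by
-- e ≥ 1 contains exactly e − 1 free vertices, so a set with d free vertices has k = n + 1 − 2r − d
-- such long gaps, and q_n^{r,d} = C(r+1, k) · multichoose k d: choose the long gaps, then distribute
-- the d free vertices among them. This closed form, valid also for r = 0, is proved by a transfer
-- recursion on the length of the path. It gives q^{r,d} · k(k − 1) = q^{r,d+1} · (r + 2 − k)(d + 1),
-- so comparing a maximiser d with d ± 1 yields two quadratic inequalities. With s = n + 1 − 2r the
-- numerator is N = s² − (r + 2) and the denominator is D = s + r + 2, and the two inequalities say
-- exactly (d − 1)·D ≤ N ≤ d·D.

module Submission where

open import Defs
open import Data.Nat as ℕ using (ℕ; ⌈_/2⌉)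
open import Data.Integer as ℤ using (ℤ; +_)
open import Data.Sum using (_⊎_)
open import Relation.Binary.PropositionalEquality using (_≡_)

module Counting where
  open import Data.Bool using (Bool; true; false; _∧_; _∨_; not)
  open import Data.Bool.Properties using (∧-zeroʳ)
  open import Data.Fin using (Fin; zero; suc)
  open import Data.List using (List; []; _∷_; _++_; map; length; filterᵇ; allFin)
  open import Data.List.Properties using (filter-++; length-++; map-tabulate)
  open import Data.Nat using (zero; suc; _+_; _*_; _≤_; _<_; _≤?_; _≡ᵇ_; z≤n; s≤s; s≤s⁻¹; >-nonZero)
  open import Data.Nat.Properties
  open import Algebra.Properties.CommutativeSemigroup *-commutativeSemigroup using (interchange)
  open import Data.Nat.Combinatorics using (_C_; nCk+nC[k+1]≡[n+1]C[k+1]; nCn≡1; k>n⇒nCk≡0)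
  open import Data.Nat.Tactic.RingSolver using (solve-∀)
  open import Data.Product using (∃; ∃₂; _×_; _,_)
  open import Data.Vec using (Vec; []; _∷_; lookup; _[_]≔_)
  open import Function using (_∘_; id)
  open import Relation.Binary.PropositionalEquality
  open import Relation.Nullary using (yes; no; contradiction)
  open import Relation.Nullary.Decidable using (T?)
  open ≡-Reasoning

  multichoose : ℕ → ℕ → ℕ
  multichoose k       zero    = 1
  multichoose zero    (suc d) = 0
  multichoose (suc k) (suc d) = multichoose k (suc d) + multichoose (suc k) d

  multichoose-one-kind : ∀ d → multichoose 1 d ≡ 1
  multichoose-one-kind zero    = refl
  multichoose-one-kind (suc d) = multichoose-one-kind d

  multichoose-size-one : ∀ k → multichoose k 1 ≡ k
  multichoose-size-one zero    = refl
  multichoose-size-one (suc k) = trans (+-comm (multichoose k 1) 1) (cong suc (multichoose-size-one k))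

  multichoose-pos : ∀ k d → 0 < multichoose (suc k) d
  multichoose-pos k zero    = s≤s z≤n
  multichoose-pos k (suc d) = <-≤-trans (multichoose-pos k d) (m≤n+m _ _)

  multichoose-ratio : ∀ k d → suc d * multichoose k (suc d) ≡ k * multichoose (suc k) d
  multichoose-ratio zero    d       = *-zeroʳ (suc d)
  multichoose-ratio (suc k) zero    =
    trans (+-identityʳ _) (trans (multichoose-size-one (suc k)) (sym (*-identityʳ (suc k))))
  multichoose-ratio (suc k) (suc d) = begin
    suc (suc d) * (multichoose k (suc (suc d)) + X)
      ≡⟨ *-distribˡ-+ (suc (suc d)) (multichoose k (suc (suc d))) X ⟩
    suc (suc d) * multichoose k (suc (suc d)) + suc (suc d) * X
      ≡⟨ cong (_+ suc (suc d) * X) (multichoose-ratio k (suc d)) ⟩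
    k * X + suc (suc d) * X
      ≡⟨ sym (*-distribʳ-+ X k (suc (suc d))) ⟩
    (k + suc (suc d)) * X
      ≡⟨ cong (_* X) (+-suc k (suc d)) ⟩
    (suc k + suc d) * X
      ≡⟨ *-distribʳ-+ X (suc k) (suc d) ⟩
    suc k * X + suc d * X
      ≡⟨ cong (_+_ (suc k * X)) (multichoose-ratio (suc k) d) ⟩
    suc k * X + suc k * multichoose (suc (suc k)) d
      ≡⟨ sym (*-distribˡ-+ (suc k) X _) ⟩
    suc k * (X + multichoose (suc (suc k)) d) ∎
    where X = multichoose (suc k) (suc d)

  binomial≡multichoose : ∀ k u → (k + u) C k ≡ multichoose (suc u) k
  binomial≡multichoose zero    u       = refl
  binomial≡multichoose (suc k) zero    =
    trans (cong (_C suc k) (+-identityʳ (suc k))) (trans (nCn≡1 (suc k)) (sym (multichoose-one-kind (suc k))))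
  binomial≡multichoose (suc k) (suc u) = begin
    (suc k + suc u) C suc k
      ≡⟨ sym (nCk+nC[k+1]≡[n+1]C[k+1] (k + suc u) k) ⟩
    (k + suc u) C k + (k + suc u) C suc k
      ≡⟨ cong₂ _+_ (binomial≡multichoose k (suc u)) (cong (_C suc k) (+-suc k u)) ⟩
    multichoose (suc (suc u)) k + (suc k + u) C suc k
      ≡⟨ cong (_+_ (multichoose (suc (suc u)) k)) (binomial≡multichoose (suc k) u) ⟩
    multichoose (suc (suc u)) k + multichoose (suc u) (suc k)
      ≡⟨ +-comm _ (multichoose (suc u) (suc k)) ⟩
    multichoose (suc (suc u)) (suc k) ∎

  binomial-pos : ∀ {n k} → k ≤ n → 0 < n C k
  binomial-pos {n} {k} k≤n with m≤n⇒∃[o]m+o≡n k≤n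
  ... | u , refl = subst (0 <_) (sym (binomial≡multichoose k u)) (multichoose-pos u k)

  binomial-ratio : ∀ k u → ((k + u) C suc k) * suc k ≡ ((k + u) C k) * u
  binomial-ratio k zero = begin
    ((k + 0) C suc k) * suc k ≡⟨ cong (_* suc k) (k>n⇒nCk≡0 (s≤s (≤-reflexive (+-identityʳ k)))) ⟩
    0                         ≡⟨ sym (*-zeroʳ ((k + 0) C k)) ⟩
    ((k + 0) C k) * 0         ∎
  binomial-ratio k (suc u) = begin
    ((k + suc u) C suc k) * suc k         ≡⟨ cong (λ m → (m C suc k) * suc k) (+-suc k u) ⟩
    ((suc k + u) C suc k) * suc k         ≡⟨ cong (_* suc k) (binomial≡multichoose (suc k) u) ⟩
    multichoose (suc u) (suc k) * suc k   ≡⟨ *-comm _ (suc k) ⟩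
    suc k * multichoose (suc u) (suc k)   ≡⟨ multichoose-ratio (suc u) k ⟩
    suc u * multichoose (suc (suc u)) k   ≡⟨ *-comm (suc u) _ ⟩
    multichoose (suc (suc u)) k * suc u   ≡⟨ cong (_* suc u) (sym (binomial≡multichoose k (suc u))) ⟩
    ((k + suc u) C k) * suc u             ∎

  a*x≡b*y∧b≤a⇒x≤y : ∀ {a b x y} → 0 < a → a * x ≡ b * y → b ≤ a → x ≤ y
  a*x≡b*y∧b≤a⇒x≤y {a} {b} {x} {y} a>0 eq b≤a =
    *-cancelˡ-≤ a {{>-nonZero a>0}} (≤-trans (≤-reflexive eq) (*-monoˡ-≤ y b≤a))

  a+b≡c+e∧e≤b⇒a≤c : ∀ {a b c e} → a + b ≡ c + e → e ≤ b → a ≤ c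
  a+b≡c+e∧e≤b⇒a≤c {a} {b} {c} eq e≤b =
    +-cancelʳ-≤ b a c (≤-trans (≤-reflexive eq) (+-monoʳ-≤ c e≤b))

  indicator : Bool → ℕ
  indicator true  = 1
  indicator false = 0

  countᵇ : {A : Set} → (A → Bool) → List A → ℕ
  countᵇ p xs = length (filterᵇ p xs)

  module _ {A : Set} where

    countᵇ-∷ : ∀ (p : A → Bool) x xs → countᵇ p (x ∷ xs) ≡ indicator (p x) + countᵇ p xs
    countᵇ-∷ p x xs with p x
    ... | true  = refl
    ... | false = refl

    countᵇ-singleton : ∀ (p : A → Bool) x → countᵇ p (x ∷ []) ≡ indicator (p x)
    countᵇ-singleton p x = trans (countᵇ-∷ p x []) (+-identityʳ _)

    countᵇ-++ : ∀ (p : A → Bool) xs ys → countᵇ p (xs ++ ys) ≡ countᵇ p xs + countᵇ p ys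
    countᵇ-++ p xs ys = trans (cong length (filter-++ (T? ∘ p) xs ys)) (length-++ (filterᵇ p xs))

    countᵇ-map : ∀ {B : Set} (p : B → Bool) (f : A → B) xs → countᵇ p (map f xs) ≡ countᵇ (p ∘ f) xs
    countᵇ-map p f []       = refl
    countᵇ-map p f (x ∷ xs) with p (f x)
    ... | true  = cong suc (countᵇ-map p f xs)
    ... | false = countᵇ-map p f xs

    countᵇ-cong : ∀ {p p′ : A → Bool} → (∀ x → p x ≡ p′ x) →
      ∀ xs → countᵇ p xs ≡ countᵇ p′ xs
    countᵇ-cong         eq []       = refl
    countᵇ-cong {p} {p′} eq (x ∷ xs) = begin
      countᵇ p (x ∷ xs)                   ≡⟨ countᵇ-∷ p x xs ⟩
      indicator (p x) + countᵇ p xs       ≡⟨ cong₂ _+_ (cong indicator (eq x)) (countᵇ-cong eq xs) ⟩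
      indicator (p′ x) + countᵇ p′ xs     ≡⟨ countᵇ-∷ p′ x xs ⟨
      countᵇ p′ (x ∷ xs)                  ∎

    countᵇ-none : ∀ {p : A → Bool} → (∀ x → p x ≡ false) → ∀ xs → countᵇ p xs ≡ 0
    countᵇ-none     never []       = refl
    countᵇ-none {p} never (x ∷ xs) =
      trans (countᵇ-∷ p x xs) (cong₂ _+_ (cong indicator (never x)) (countᵇ-none never xs))

  countᵇ-allFin-suc : ∀ {n} (p : Fin (suc n) → Bool) →
    countᵇ p (allFin (suc n)) ≡ indicator (p zero) + countᵇ (p ∘ suc) (allFin n)
  countᵇ-allFin-suc {n} p = trans (countᵇ-∷ p zero _)
    (cong (_+_ (indicator (p zero)))
      (trans (cong (countᵇ p) (sym (map-tabulate id suc))) (countᵇ-map p suc (allFin n))))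

  countᵇ-allSubsets-suc : ∀ n (p : Vec Bool (suc n) → Bool) →
    countᵇ p (allSubsets (suc n))
      ≡ countᵇ (p ∘ (false ∷_)) (allSubsets n) + countᵇ (p ∘ (true ∷_)) (allSubsets n)
  countᵇ-allSubsets-suc n p = trans (countᵇ-++ p (map (false ∷_) (allSubsets n)) _)
    (cong₂ _+_ (countᵇ-map p (false ∷_) (allSubsets n)) (countᵇ-map p (true ∷_) (allSubsets n)))

  -- The Bool argument of independentAfter, freeAfter, extendableAfter and hasProfile says whether
  -- the vertex just left of the vector is in the set.
  independentAfter : ∀ {n} → Bool → Vec Bool n → Bool
  independentAfter l []       = true
  independentAfter l (x ∷ xs) = not (l ∧ x) ∧ independentAfter x xs

  firstᵇ : ∀ {n} → Vec Bool n → Bool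
  firstᵇ []      = false
  firstᵇ (x ∷ _) = x

  freeAfter : ∀ {n} → Bool → Vec Bool n → ℕ
  freeAfter l []           = 0
  freeAfter l (true ∷ xs)  = freeAfter true xs
  freeAfter l (false ∷ xs) = indicator (not (l ∨ firstᵇ xs)) + freeAfter false xs

  noTwoConsecutive≡independentAfter : ∀ {n} (v : Vec Bool n) →
    noTwoConsecutive v ≡ independentAfter false v
  noTwoConsecutive≡independentAfter []       = refl
  noTwoConsecutive≡independentAfter (x ∷ xs) = go x xs
    where
    go : ∀ {n} x (xs : Vec Bool n) → noTwoConsecutive (x ∷ xs) ≡ independentAfter x xs
    go x []       = refl
    go x (y ∷ ys) = cong (not (x ∧ y) ∧_) (go y ys)

  extendableAfter : ∀ {n} → Bool → Vec Bool n → Fin n → Bool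
  extendableAfter l v b = not (lookup v b) ∧ independentAfter l (v [ b ]≔ true)

  independentAfter-true : ∀ {n} (v : Vec Bool n) → independentAfter false v ≡ true →
    independentAfter true v ≡ not (firstᵇ v)
  independentAfter-true []           _     = refl
  independentAfter-true (true ∷ xs)  _     = refl
  independentAfter-true (false ∷ xs) indep = indep

  countᵇ-extendableAfter : ∀ {n} l (v : Vec Bool n) → independentAfter l v ≡ true →
    countᵇ (extendableAfter l v) (allFin n) ≡ freeAfter l v
  countᵇ-extendableAfter l     []           _     = refl
  countᵇ-extendableAfter true  (true ∷ xs)  ()
  countᵇ-extendableAfter true  (false ∷ xs) indep =
    trans (countᵇ-allFin-suc (extendableAfter true (false ∷ xs))) (countᵇ-extendableAfter false xs indep)
  countᵇ-extendableAfter false (true ∷ xs)  indep =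
    trans (countᵇ-allFin-suc (extendableAfter false (true ∷ xs))) (countᵇ-extendableAfter true xs indep)
  countᵇ-extendableAfter false (false ∷ xs) indep =
    trans (countᵇ-allFin-suc (extendableAfter false (false ∷ xs)))
    (cong₂ _+_ (cong indicator (independentAfter-true xs indep)) (countᵇ-extendableAfter false xs indep))

  dplus≡freeAfter : ∀ {n} (v : Vec Bool n) → independentAfter false v ≡ true →
    dplus v ≡ freeAfter false v
  dplus≡freeAfter {n} v indep = trans
    (countᵇ-cong (λ b → cong (not (lookup v b) ∧_) (noTwoConsecutive≡independentAfter (v [ b ]≔ true)))
                 (allFin n))
    (countᵇ-extendableAfter false v indep)

  hasProfile : ∀ {n} → Bool → ℕ → ℕ → Vec Bool n → Bool
  hasProfile l r d v = independentAfter l v ∧ (size v ≡ᵇ r) ∧ (freeAfter l v ≡ᵇ d)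

  q≡countᵇ-hasProfile : ∀ n r d → q n r d ≡ countᵇ (hasProfile false r d) (allSubsets n)
  q≡countᵇ-hasProfile n r d = countᵇ-cong agree (allSubsets n)
    where
    agree : ∀ v → (noTwoConsecutive v ∧ (size v ≡ᵇ r) ∧ (dplus v ≡ᵇ d)) ≡ hasProfile false r d v
    agree v rewrite noTwoConsecutive≡independentAfter v with independentAfter false v in indep
    ... | true  = cong (λ e → (size v ≡ᵇ r) ∧ (e ≡ᵇ d)) (dplus≡freeAfter v indep)
    ... | false = refl

  isEmptyProfile : ℕ → ℕ → ℕ
  isEmptyProfile r d = indicator ((0 ≡ᵇ r) ∧ (0 ≡ᵇ d))

  -- afterIn m r d counts the sets on m vertices after a vertex in the set; the sets on m vertices
  -- after a vertex not in the set are split into startIn m (first vertex in the set) and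
  -- startOut m (first vertex not in the set, or m = 0).
  afterIn startIn startOut : ℕ → ℕ → ℕ → ℕ
  afterIn zero    r d = isEmptyProfile r d
  afterIn (suc m) r d = startIn m r d + startOut m r d
  startIn zero    r       d = 0
  startIn (suc m) zero    d = 0
  startIn (suc m) (suc r) d = afterIn m r d
  startOut zero    r d       = isEmptyProfile r d
  startOut (suc m) r zero    = startIn m r zero
  startOut (suc m) r (suc d) = startIn m r (suc d) + startOut m r d

  countᵇ-afterIn : ∀ m r d → countᵇ (hasProfile true r d) (allSubsets m) ≡ afterIn m r d
  countᵇ-afterOut : ∀ m r d → countᵇ (hasProfile false r d) (allSubsets m) ≡ afterIn (suc m) r d
  countᵇ-startIn : ∀ m r d →
    countᵇ (hasProfile false r d ∘ (true ∷_)) (allSubsets m) ≡ startIn (suc m) r d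
  countᵇ-startOut : ∀ m r d →
    countᵇ (hasProfile false r d ∘ (false ∷_)) (allSubsets m) ≡ startOut (suc m) r d

  countᵇ-afterIn zero    r d = countᵇ-singleton (hasProfile true r d) []
  countᵇ-afterIn (suc m) r d = begin
    countᵇ (hasProfile true r d) (allSubsets (suc m))
      ≡⟨ countᵇ-allSubsets-suc m (hasProfile true r d) ⟩
    countᵇ (hasProfile false r d) (allSubsets m) + countᵇ (λ _ → false) (allSubsets m)
      ≡⟨ cong₂ _+_ (countᵇ-afterOut m r d) (countᵇ-none (λ _ → refl) (allSubsets m)) ⟩
    afterIn (suc m) r d + 0
      ≡⟨ +-identityʳ _ ⟩
    afterIn (suc m) r d ∎

  countᵇ-afterOut zero    r d = countᵇ-singleton (hasProfile false r d) []
  countᵇ-afterOut (suc m) r d =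
    trans (countᵇ-allSubsets-suc m (hasProfile false r d))
      (trans (cong₂ _+_ (countᵇ-startOut m r d) (countᵇ-startIn m r d)) (+-comm (startOut (suc m) r d) _))

  countᵇ-startIn m zero    d = countᵇ-none (λ w → ∧-zeroʳ (independentAfter true w)) (allSubsets m)
  countᵇ-startIn m (suc r) d = countᵇ-afterIn m r d

  countᵇ-startOut zero zero    zero    = countᵇ-singleton (hasProfile false 0 0 ∘ (false ∷_)) []
  countᵇ-startOut zero (suc r) zero    = countᵇ-singleton (hasProfile false (suc r) 0 ∘ (false ∷_)) []
  countᵇ-startOut zero r       (suc d) = countᵇ-singleton (hasProfile false r (suc d) ∘ (false ∷_)) []
  countᵇ-startOut (suc m) r zero =
    trans (countᵇ-allSubsets-suc m _)
      (cong₂ _+_ (countᵇ-none noFreeStart (allSubsets m)) (countᵇ-startIn m r zero))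
    where
    noFreeStart : ∀ w → hasProfile false r zero (false ∷ false ∷ w) ≡ false
    noFreeStart w = trans (cong (independentAfter false w ∧_) (∧-zeroʳ (size w ≡ᵇ r))) (∧-zeroʳ _)
  countᵇ-startOut (suc m) r (suc d) =
    trans (countᵇ-allSubsets-suc m _)
      (trans (cong₂ _+_ (countᵇ-startOut m r d) (countᵇ-startIn m r (suc d))) (+-comm (startOut (suc m) r d) _))

  -- Lengths are written r * 2 + …, not r + r + …, because r * 2 computes when r is a successor.
  afterIn-closed : ∀ m r d k → m ≡ r * 2 + (d + k) → afterIn m r d ≡ (suc r C k) * multichoose k d
  startIn-closed : ∀ m r d k → suc m ≡ r * 2 + (d + k) → startIn m r d ≡ (r C k) * multichoose k d
  startOut-closed : ∀ m r d k → suc m ≡ r * 2 + (d + suc k) →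
    startOut m r d ≡ (r C k) * multichoose (suc k) d
  startOut-vanishes : ∀ m r d → suc m ≤ r * 2 + d → startOut m r d ≡ 0
  startIn-vanishes : ∀ m r d → suc m < r * 2 + d → startIn m r d ≡ 0
  afterIn-vanishes : ∀ m r d → m < r * 2 + d → afterIn m r d ≡ 0

  afterIn-closed zero    zero    zero    zero    refl = refl
  afterIn-closed (suc m) r d zero eq = begin
    startIn m r d + startOut m r d  ≡⟨ cong₂ _+_ (startIn-closed m r d 0 eq) (startOut-vanishes m r d le) ⟩
    (r C 0) * multichoose 0 d + 0     ≡⟨ +-identityʳ _ ⟩
    (suc r C 0) * multichoose 0 d     ∎
    where
    le : suc m ≤ r * 2 + d
    le = ≤-reflexive (trans eq (cong (_+_ (r * 2)) (+-identityʳ d)))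
  afterIn-closed (suc m) r d (suc k) eq = begin
    startIn m r d + startOut m r d
      ≡⟨ cong₂ _+_ (startIn-closed m r d (suc k) eq) (startOut-closed m r d k eq) ⟩
    (r C suc k) * multichoose (suc k) d + (r C k) * multichoose (suc k) d
      ≡⟨ sym (*-distribʳ-+ (multichoose (suc k) d) (r C suc k) (r C k)) ⟩
    (r C suc k + r C k) * multichoose (suc k) d
      ≡⟨ cong (_* multichoose (suc k) d) (trans (+-comm (r C suc k) (r C k)) (nCk+nC[k+1]≡[n+1]C[k+1] r k)) ⟩
    (suc r C suc k) * multichoose (suc k) d ∎

  startIn-closed zero    zero    (suc d) zero    eq = refl
  startIn-closed zero    zero    d       (suc k) eq = refl
  startIn-closed (suc m) zero    (suc d) zero    eq = refl
  startIn-closed (suc m) zero    d       (suc k) eq = refl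
  startIn-closed (suc m) (suc r) d k refl = afterIn-closed m r d k refl

  startOut-closed zero zero zero zero refl = refl
  startOut-closed zero zero (suc zero) k ()
  startOut-closed zero zero (suc (suc d)) k ()
  startOut-closed (suc m) r zero k eq = startIn-closed m r 0 k (suc-injective (trans eq (+-suc (r * 2) k)))
  startOut-closed (suc m) r (suc d) k eq = begin
    startIn m r (suc d) + startOut m r d
      ≡⟨ cong₂ _+_ (startIn-closed m r (suc d) k eq′) (startOut-closed m r d k eq″) ⟩
    (r C k) * multichoose k (suc d) + (r C k) * multichoose (suc k) d
      ≡⟨ sym (*-distribˡ-+ (r C k) (multichoose k (suc d)) _) ⟩
    (r C k) * multichoose (suc k) (suc d) ∎
    where
    eq″ : suc m ≡ r * 2 + (d + suc k)
    eq″ = suc-injective (trans eq (+-suc (r * 2) (d + suc k)))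
    eq′ : suc m ≡ r * 2 + (suc d + k)
    eq′ = trans eq″ (cong (_+_ (r * 2)) (+-suc d k))

  startOut-vanishes zero zero    (suc d) _  = refl
  startOut-vanishes zero (suc r) d       _  = refl
  startOut-vanishes (suc m) r zero    le = startIn-vanishes m r zero le
  startOut-vanishes (suc m) r (suc d) le =
    cong₂ _+_ (startIn-vanishes m r (suc d) le)
              (startOut-vanishes m r d (s≤s⁻¹ (≤-trans le (≤-reflexive (+-suc (r * 2) d)))))

  startIn-vanishes zero    r       d _ = refl
  startIn-vanishes (suc m) zero    d _ = refl
  startIn-vanishes (suc m) (suc r) d (s≤s (s≤s lt)) = afterIn-vanishes m r d lt

  afterIn-vanishes zero    zero    (suc d) _  = refl
  afterIn-vanishes zero    (suc r) d       _  = refl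
  afterIn-vanishes (suc m) r       d       lt =
    cong₂ _+_ (startIn-vanishes m r d lt) (startOut-vanishes m r d (<⇒≤ lt))

  q≡afterIn : ∀ n r d → q n r d ≡ afterIn (suc n) r d
  q≡afterIn n r d = trans (q≡countᵇ-hasProfile n r d) (countᵇ-afterOut n r d)

  q-closed : ∀ {n r d k} → suc n ≡ r * 2 + (d + k) → q n r d ≡ (suc r C k) * multichoose k d
  q-closed {n} {r} {d} {k} eq = trans (q≡afterIn n r d) (afterIn-closed (suc n) r d k eq)

  q-vanishes : ∀ {n r d} → suc n < r * 2 + d → q n r d ≡ 0
  q-vanishes {n} {r} {d} lt = trans (q≡afterIn n r d) (afterIn-vanishes (suc n) r d lt)

  q-ratio : ∀ {n r d k u} → suc n ≡ r * 2 + (d + suc k) → r ≡ k + u →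
    q n r d * (suc k * k) ≡ q n r (suc d) * (suc u * suc d)
  q-ratio {n} {r} {d} {k} {u} eq refl = begin
    q n r d * (suc k * k)
      ≡⟨ cong (_* (suc k * k)) (q-closed eq) ⟩
    ((suc r C suc k) * multichoose (suc k) d) * (suc k * k)
      ≡⟨ interchange (suc r C suc k) _ (suc k) k ⟩
    ((suc r C suc k) * suc k) * (multichoose (suc k) d * k)
      ≡⟨ cong₂ _*_ binomial-step multichoose-step ⟩
    ((suc r C k) * suc u) * (multichoose k (suc d) * suc d)
      ≡⟨ interchange (suc r C k) (suc u) _ (suc d) ⟩
    ((suc r C k) * multichoose k (suc d)) * (suc u * suc d)
      ≡⟨ cong (_* (suc u * suc d)) (sym (q-closed eq′)) ⟩
    q n r (suc d) * (suc u * suc d) ∎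
    where
    eq′ : suc n ≡ r * 2 + (suc d + k)
    eq′ = trans eq (cong (_+_ (r * 2)) (+-suc d k))
    binomial-step : ((suc r C suc k) * suc k) ≡ ((suc r C k) * suc u)
    binomial-step = subst (λ m → (m C suc k) * suc k ≡ (m C k) * suc u) (+-suc k u) (binomial-ratio k (suc u))
    multichoose-step : multichoose (suc k) d * k ≡ multichoose k (suc d) * suc d
    multichoose-step = trans (*-comm _ k) (trans (sym (multichoose-ratio k d)) (*-comm (suc d) _))

  q-positive-somewhere : ∀ {n r} → r * 2 ≤ suc n → ∃ λ d → 0 < q n r d
  q-positive-somewhere {n} {r} 2r≤n+1 with m≤n⇒∃[o]m+o≡n 2r≤n+1
  ... | s , eq with s ≤? suc r
  ...   | yes s≤r+1 = 0 , subst (0 <_) (sym (q-closed (sym eq))) (*-mono-≤ (binomial-pos s≤r+1) ≤-refl)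
  ...   | no  s≰r+1 with m≤n⇒∃[o]m+o≡n (<⇒≤ (≰⇒> s≰r+1))
  ...     | d , refl =
    d , subst (0 <_) (sym (q-closed eq′)) (*-mono-≤ (binomial-pos {suc r} ≤-refl) (multichoose-pos r d))
    where
    eq′ : suc n ≡ r * 2 + (d + suc r)
    eq′ = trans (sym eq) (cong (_+_ (r * 2)) (+-comm (suc r) d))

  q-support : ∀ {n r d} → 0 < q n r d → ∃₂ λ k u → suc n ≡ r * 2 + (d + k) × suc r ≡ k + u
  q-support {n} {r} {d} q>0 with r * 2 + d ≤? suc n
  ... | no  ≰ = contradiction (q-vanishes (≰⇒> ≰)) (λ q≡0 → <-irrefl (sym q≡0) q>0)
  ... | yes ≤ with m≤n⇒∃[o]m+o≡n ≤
  ...   | k , eq with k ≤? suc r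
  ...     | no  k≰ = contradiction (trans (q-closed (trans (sym eq) (+-assoc (r * 2) d k)))
                                         (cong (_* multichoose k d) (k>n⇒nCk≡0 (≰⇒> k≰))))
                                  (λ q≡0 → <-irrefl (sym q≡0) q>0)
  ...     | yes k≤ with m≤n⇒∃[o]m+o≡n k≤
  ...       | u , eq′ = k , u , trans (sym eq) (+-assoc (r * 2) d k) , sym eq′

  ascent-bound : ∀ {n r d} k u → suc n ≡ r * 2 + (d + k) → suc r ≡ k + u →
    0 < q n r d → q n r (suc d) ≤ q n r d → k * k ≤ suc u * suc d + k
  ascent-bound zero    u _    _    _   _ = z≤n
  ascent-bound (suc k) u eq-n eq-r q>0 q[d+1]≤q[d] =
    ≤-trans (≤-reflexive (trans (*-suc (suc k) k) (+-comm (suc k) _)))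
            (+-monoˡ-≤ (suc k) (a*x≡b*y∧b≤a⇒x≤y q>0 (q-ratio eq-n (suc-injective eq-r)) q[d+1]≤q[d]))

  descent-bound : ∀ {n r d} k u → suc n ≡ r * 2 + (d + k) → suc r ≡ k + u →
    0 < q n r d → (∀ d′ → q n r d′ ≤ q n r d) → u * d ≤ suc k * k
  descent-bound {d = zero}  k u       _ _ _ _ = ≤-trans (≤-reflexive (*-zeroʳ u)) z≤n
  descent-bound {d = suc d} k zero    _ _ _ _ = z≤n
  descent-bound {n} {r} {suc d} k (suc u) eq-n eq-r q>0 maximal =
    a*x≡b*y∧b≤a⇒x≤y q>0 (sym (q-ratio eq-n′ eq-r′)) (maximal d)
    where
    eq-n′ : suc n ≡ r * 2 + (d + suc k)
    eq-n′ = trans eq-n (cong (_+_ (r * 2)) (sym (+-suc d k)))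
    eq-r′ : r ≡ k + u
    eq-r′ = suc-injective (trans eq-r (+-suc k u))

  lower-bound-ℕ : ∀ {r} d k u → suc r ≡ k + u → u * d ≤ suc k * k →
    d * ((d + k) + suc (suc r)) ≤ (d + k) * (d + k) + (d + k)
  lower-bound-ℕ d k u eq-r ud≤ rewrite eq-r = a+b≡c+e∧e≤b⇒a≤c (identity d k u) ud≤
    where
    identity : ∀ d k u → d * ((d + k) + suc (k + u)) + suc k * k ≡ ((d + k) * (d + k) + (d + k)) + u * d
    identity = solve-∀

  upper-bound-ℕ : ∀ {r} d k u → suc r ≡ k + u → k * k ≤ suc u * suc d + k →
    (d + k) * (d + k) ≤ d * ((d + k) + suc (suc r)) + suc (suc r)
  upper-bound-ℕ d k u eq-r kk≤ rewrite eq-r = a+b≡c+e∧e≤b⇒a≤c (identity d k u) kk≤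
    where
    identity : ∀ d k u →
      (d + k) * (d + k) + (suc u * suc d + k) ≡ (d * ((d + k) + suc (k + u)) + suc (k + u)) + k * k
    identity = solve-∀

  maximiser-bounds : ∀ {n r d} → 0 < q n r d → (∀ d′ → q n r d′ ≤ q n r d) →
    ∃ λ s → suc n ≡ r * 2 + s
          × d * (s + suc (suc r)) ≤ s * s + s
          × s * s ≤ d * (s + suc (suc r)) + suc (suc r)
  maximiser-bounds {n} {r} {d} q>0 maximal with q-support q>0
  ... | k , u , eq-n , eq-r =
    d + k , eq-n ,
    lower-bound-ℕ d k u eq-r (descent-bound k u eq-n eq-r q>0 maximal) ,
    upper-bound-ℕ d k u eq-r (ascent-bound k u eq-n eq-r q>0 (maximal (suc d)))

module Arithmetic where
  open import Data.Nat using (zero; suc; NonZero)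
  open import Data.Integer using (-_; _+_; _-_; _*_; _≤_; _<_; +≤+; 0ℤ)
  open import Data.Integer.Properties
  open import Data.Integer.DivMod using (_/ℕ_; [n/ℕd]*d≤n; n<s[n/ℕd]*d)
  open import Data.Integer.Tactic.RingSolver using (solve-∀)
  import Data.Nat.Properties as ℕₚ
  import Data.Nat.Tactic.RingSolver as ℕ-Solver
  open import Data.Product using (_×_; _,_)
  open import Data.Sum using (inj₁; inj₂)
  open import Relation.Binary.PropositionalEquality
  open import Relation.Nullary using (yes; no)

  /ℕ-unique : ∀ a D .{{_ : NonZero D}} q → q * + D ≤ a → a < ℤ.suc q * + D → a /ℕ D ≡ q
  /ℕ-unique a D q lower upper = ≤-antisym
    (below (≤-<-trans ([n/ℕd]*d≤n a D) upper))
    (below (≤-<-trans lower (n<s[n/ℕd]*d a D)))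
    where
    below : ∀ {i j} → i * + D < ℤ.suc j * + D → i ≤ j
    below {i} {j} lt = subst (i ≤_) (pred-suc j) (i<j⇒i≤pred[j] {j = ℤ.suc j} (*-cancelʳ-<-nonNeg (+ D) lt))

  ceilDiv-unique : ∀ N D .{{_ : NonZero D}} d → (d - + 1) * + D < N → N ≤ d * + D → ceilDiv N D ≡ d
  ceilDiv-unique N D d lower upper = trans (cong -_ (/ℕ-unique (- N) D (- d) lower′ upper′)) (neg-involutive d)
    where
    lower′ : - d * + D ≤ - N
    lower′ = subst (_≤ - N) (neg-distribˡ-* d (+ D)) (neg-mono-≤ upper)
    upper′ : - N < ℤ.suc (- d) * + D
    upper′ = subst (- N <_) (negated d (+ D)) (neg-mono-< lower)
      where
      negated : ∀ x y → - ((x - + 1) * y) ≡ (+ 1 + - x) * y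
      negated = solve-∀

  ceilDiv-or-exact : ∀ N D .{{_ : NonZero D}} d → (d - + 1) * + D ≤ N → N ≤ d * + D →
    (d ≡ ceilDiv N D) ⊎ ((d - + 1) * + D ≡ N)
  ceilDiv-or-exact N D d lower upper with (d - + 1) * + D ≟ N
  ... | yes exact = inj₂ exact
  ... | no  inexact = inj₁ (sym (ceilDiv-unique N D d (≤∧≢⇒< lower inexact) upper))

  pos-*-+ : ∀ a b c → + (a ℕ.* b ℕ.+ c) ≡ + a * + b + + c
  pos-*-+ a b c = trans (pos-+ (a ℕ.* b) c) (cong (_+ + c) (pos-* a b))

  pos-*-sum : ∀ a b c → + (a ℕ.* (b ℕ.+ c)) ≡ + a * (+ b + + c)
  pos-*-sum a b c = trans (pos-* a (b ℕ.+ c)) (cong (+ a *_) (pos-+ b c))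

  numerℤ : ℤ → ℤ → ℤ
  numerℤ N R = let m = N - + 2 * R in m * m + + 2 * N - + 5 * R - + 1

  numer-as-square : ∀ {n r s} → suc n ≡ r ℕ.* 2 ℕ.+ s → numer n r ≡ + (s ℕ.* s) - + suc (suc r)
  numer-as-square {n} {r} {s} eq = begin
    numerℤ (+ n) (+ r)                          ≡⟨ cong (λ N → numerℤ N (+ r)) n-as-ℤ ⟩
    numerℤ (+ r * + 2 + + s - + 1) (+ r)        ≡⟨ polynomial (+ r) (+ s) ⟩
    + s * + s - (+ 2 + + r)                     ≡⟨ cong₂ _-_ (sym (pos-* s s)) (sym (pos-+ 2 r)) ⟩
    + (s ℕ.* s) - + suc (suc r)                 ∎
    where
    open ≡-Reasoning
    polynomial : ∀ R S → (R * + 2 + S - + 1 - + 2 * R) * (R * + 2 + S - + 1 - + 2 * R)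
                           + + 2 * (R * + 2 + S - + 1) - + 5 * R - + 1 ≡ S * S - (+ 2 + R)
    polynomial = solve-∀
    n-as-ℤ : + n ≡ + r * + 2 + + s - + 1
    n-as-ℤ = begin
      + n                          ≡⟨ solve-∀ ⟩
      + 1 + + n - + 1              ≡⟨ cong (_- + 1) (sym (pos-+ 1 n)) ⟩
      + suc n - + 1                ≡⟨ cong (λ m → + m - + 1) eq ⟩
      + (r ℕ.* 2 ℕ.+ s) - + 1      ≡⟨ cong (_- + 1) (pos-*-+ r 2 s) ⟩
      + r * + 2 + + s - + 1        ∎

  denominator-as-sum : ∀ {n r s} → r ℕ.≤ n → suc n ≡ r ℕ.* 2 ℕ.+ s →
    3 ℕ.+ (n ℕ.∸ r) ≡ s ℕ.+ suc (suc r)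
  denominator-as-sum {n} {r} {s} r≤n eq = begin
    2 ℕ.+ suc (n ℕ.∸ r)            ≡⟨ cong (2 ℕ.+_) (ℕₚ.+-∸-assoc 1 r≤n) ⟨
    2 ℕ.+ (suc n ℕ.∸ r)            ≡⟨ cong (λ m → 2 ℕ.+ (m ℕ.∸ r)) (trans eq (regroup r s)) ⟩
    2 ℕ.+ (r ℕ.+ (r ℕ.+ s) ℕ.∸ r)  ≡⟨ cong (2 ℕ.+_) (ℕₚ.m+n∸m≡n r (r ℕ.+ s)) ⟩
    2 ℕ.+ (r ℕ.+ s)                ≡⟨ reorder r s ⟩
    s ℕ.+ suc (suc r)              ∎
    where
    open ≡-Reasoning
    regroup : ∀ r s → r ℕ.* 2 ℕ.+ s ≡ r ℕ.+ (r ℕ.+ s)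
    regroup = ℕ-Solver.solve-∀
    reorder : ∀ r s → 2 ℕ.+ (r ℕ.+ s) ≡ s ℕ.+ suc (suc r)
    reorder = ℕ-Solver.solve-∀

  ≤-from-ℕ-gap : ∀ {i j a b} → b ℕ.≤ a → + a - + b ≡ j - i → i ≤ j
  ≤-from-ℕ-gap b≤a gap = 0≤i-j⇒j≤i (subst (0ℤ ≤_) gap (i≤j⇒0≤j-i (+≤+ b≤a)))

  ℤ-lower-bound : ∀ d s t → d ℕ.* (s ℕ.+ t) ℕ.≤ s ℕ.* s ℕ.+ s →
    (+ d - + 1) * + (s ℕ.+ t) ≤ + (s ℕ.* s) - + t
  ℤ-lower-bound d s t le = ≤-from-ℕ-gap le difference
    where
    polynomial : ∀ D S T → (S * S + S) - D * (S + T) ≡ (S * S - T) - (D - + 1) * (S + T)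
    polynomial = solve-∀
    difference : + (s ℕ.* s ℕ.+ s) - + (d ℕ.* (s ℕ.+ t)) ≡ (+ (s ℕ.* s) - + t) - (+ d - + 1) * + (s ℕ.+ t)
    difference = begin
      + (s ℕ.* s ℕ.+ s) - + (d ℕ.* (s ℕ.+ t))
        ≡⟨ cong₂ _-_ (pos-*-+ s s s) (pos-*-sum d s t) ⟩
      (+ s * + s + + s) - + d * (+ s + + t)
        ≡⟨ polynomial (+ d) (+ s) (+ t) ⟩
      (+ s * + s - + t) - (+ d - + 1) * (+ s + + t)
        ≡⟨ cong₂ (λ x y → (x - + t) - (+ d - + 1) * y) (pos-* s s) (pos-+ s t) ⟨
      (+ (s ℕ.* s) - + t) - (+ d - + 1) * + (s ℕ.+ t) ∎
      where open ≡-Reasoning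

  ℤ-upper-bound : ∀ d s t → s ℕ.* s ℕ.≤ d ℕ.* (s ℕ.+ t) ℕ.+ t →
    + (s ℕ.* s) - + t ≤ + d * + (s ℕ.+ t)
  ℤ-upper-bound d s t le = ≤-from-ℕ-gap le difference
    where
    polynomial : ∀ D S T → (D * (S + T) + T) - S * S ≡ D * (S + T) - (S * S - T)
    polynomial = solve-∀
    difference : + (d ℕ.* (s ℕ.+ t) ℕ.+ t) - + (s ℕ.* s) ≡ + d * + (s ℕ.+ t) - (+ (s ℕ.* s) - + t)
    difference = begin
      + (d ℕ.* (s ℕ.+ t) ℕ.+ t) - + (s ℕ.* s)
        ≡⟨ cong₂ _-_ (trans (pos-+ _ t) (cong (_+ + t) (pos-*-sum d s t))) (pos-* s s) ⟩
      (+ d * (+ s + + t) + + t) - + s * + s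
        ≡⟨ polynomial (+ d) (+ s) (+ t) ⟩
      + d * (+ s + + t) - (+ s * + s - + t)
        ≡⟨ cong₂ (λ x y → + d * y - (x - + t)) (pos-* s s) (pos-+ s t) ⟨
      + d * + (s ℕ.+ t) - (+ (s ℕ.* s) - + t) ∎
      where open ≡-Reasoning

  numer-bounds : ∀ {n r d s} → r ℕ.≤ n → suc n ≡ r ℕ.* 2 ℕ.+ s →
    d ℕ.* (s ℕ.+ suc (suc r)) ℕ.≤ s ℕ.* s ℕ.+ s →
    s ℕ.* s ℕ.≤ d ℕ.* (s ℕ.+ suc (suc r)) ℕ.+ suc (suc r) →
    (+ d - + 1) * + (3 ℕ.+ (n ℕ.∸ r)) ≤ numer n r × numer n r ≤ + d * + (3 ℕ.+ (n ℕ.∸ r))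
  numer-bounds {n} {r} {d} {s} r≤n eq lower upper =
    subst₂ _≤_ (cong (λ D → (+ d - + 1) * + D) (sym D≡)) (sym N≡)
      (ℤ-lower-bound d s (suc (suc r)) lower) ,
    subst₂ _≤_ (sym N≡) (cong (λ D → + d * + D) (sym D≡))
      (ℤ-upper-bound d s (suc (suc r)) upper)
    where
    N≡ = numer-as-square {n} {r} eq
    D≡ = denominator-as-sum r≤n eq

open Counting
open Arithmetic
open import Data.Nat using (zero; suc; z≤n; s≤s)
import Data.Nat.Properties as ℕₚ
open import Data.Product using (_,_)
open import Data.Sum using (map₂)
open import Relation.Binary.PropositionalEquality using (subst)

⌈n/2⌉*2≤1+n : ∀ n → ⌈ n /2⌉ ℕ.* 2 ℕ.≤ suc n
⌈n/2⌉*2≤1+n zero          = z≤n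
⌈n/2⌉*2≤1+n (suc zero)    = ℕₚ.≤-refl
⌈n/2⌉*2≤1+n (suc (suc n)) = s≤s (s≤s (⌈n/2⌉*2≤1+n n))

maximiser-characterisation : ∀ {n r d} → r ℕ.≤ n →
  0 ℕ.< q n r d → (∀ d′ → q n r d′ ℕ.≤ q n r d) →
  (+ d ≡ ceilValue n r) ⊎ ((+ d ℤ.- + 1) ℤ.* + denom n r ≡ numer n r)
maximiser-characterisation {n} {r} {d} r≤n q>0 maximal =
  let s , eq , lower , upper = maximiser-bounds q>0 maximal
      N≥ , N≤ = numer-bounds {n} {r} {d} r≤n eq lower upper
  in map₂ (subst (λ D → (+ d ℤ.- + 1) ℤ.* + D ≡ numer n r) (ℕₚ.+-comm 3 (n ℕ.∸ r)))
          (ceilDiv-or-exact (numer n r) (3 ℕ.+ (n ℕ.∸ r)) (+ d) N≥ N≤)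

corollary1 : (n r : ℕ) → 1 ℕ.≤ n → r ℕ.≤ ⌈ n /2⌉ →
    (dstar : ℤ) → ((d : ℤ) → qℤ n r d ℕ.≤ qℤ n r dstar) →
    (dstar ≡ ceilValue n r)
      ⊎ ((dstar ℤ.- + 1) ℤ.* + denom n r ≡ numer n r)
corollary1 n r _ r≤⌈n/2⌉ dstar maximal =
  let d₀ , q[d₀]>0 = q-positive-somewhere (ℕₚ.≤-trans (ℕₚ.*-monoˡ-≤ 2 r≤⌈n/2⌉) (⌈n/2⌉*2≤1+n n))
  in characterise dstar maximal (ℕₚ.<-≤-trans q[d₀]>0 (maximal (+ d₀)))
  where
  characterise : ∀ dstar → ((d : ℤ) → qℤ n r d ℕ.≤ qℤ n r dstar) → 0 ℕ.< qℤ n r dstar →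
    (dstar ≡ ceilValue n r) ⊎ ((dstar ℤ.- + 1) ℤ.* + denom n r ≡ numer n r)
  -- No clause for negative dstar: there qℤ n r dstar = 0.
  characterise (+ d) maximal q>0 =
    maximiser-characterisation (ℕₚ.≤-trans r≤⌈n/2⌉ (ℕₚ.⌈n/2⌉≤n n)) q>0 (λ d′ → maximal (+ d′))
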